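{- $\mathcal L^{\sf PLTL}$ does not have the finite model property with respect to the class of bijective frames: there is a formula of $\mathcal L^{\sf PLTL}$ (for instance $\mathsf F q\wedge\neg\mathsf P q$) that is satisfied at some point of some $\sf PLTL$ model based on a bijective frame, but is not satisfied at any point of any $\sf PLTL$ model based on a finite bijective frame.
   Context: The language $\mathcal L^{\sf PLTL}$ is given by $\varphi,\psi ::= p\mid\neg\varphi\mid\varphi\wedge\psi\mid\mathsf X\varphi\mid\mathsf Y\varphi\mid\mathsf F\varphi\mid\mathsf P\varphi$, $p$ ranging over a set of atoms. A bijective frame is $(X,S)$ with $S:X\to X$ a bijection; $S^0$ is the identity, $S^{k+1}=S\circ S^k$, $S^{ -(k+1)}=S^{ -1}\circ S^{ -k}$. A $\sf PLTL$ model is a bijective frame with a valuation $[\![\cdot]\!]$ assigning subsets of $X$ to atoms. Satisfaction: atoms and Booleans as usual; $w\models\mathsf X\varphi$ iff $S(w)\models\varphi$; $w\models\mathsf Y\varphi$ iff $S^{ -1}(w)\models\varphi$; $w\models\mathsf F\varphi$ iff $S^k(w)\models\varphi$ for some $k\ge 0$; $w\models\mathsf P\varphi$ iff $S^{ -k}(w)\models\varphi$ for some $k\ge0$. -}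

module Defs where

open import Data.Nat using (ℕ; zero; suc)
open import Data.Fin using (Fin)
open import Data.Product using (Σ; ∃; _×_; _,_)
open import Data.Empty using (⊥)
open import Relation.Nullary using (¬_)
open import Function.Bundles using (Inverse; _↔_)
open import Relation.Binary.PropositionalEquality using (_≡_)

Atom : Set
Atom = ℕ

data Formula : Set where
  atom : Atom → Formula
  ¬'_  : Formula → Formula
  _∧'_ : Formula → Formula → Formula
  X'   : Formula → Formula
  Y'   : Formula → Formula
  F'   : Formula → Formula
  P'   : Formula → Formula

record BijFrame : Set₁ where
  field
    Carrier : Set
    S       : Carrier ↔ Carrier

  next : Carrier → Carrier
  next = Inverse.to S

  prev : Carrier → Carrier
  prev = Inverse.from S

  fwd : ℕ → Carrier → Carrier
  fwd zero    w = w
  fwd (suc k) w = next (fwd k w)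

  bwd : ℕ → Carrier → Carrier
  bwd zero    w = w
  bwd (suc k) w = prev (bwd k w)

record Model : Set₁ where
  field
    frame : BijFrame
  open BijFrame frame public
  field
    val : Atom → Carrier → Set

FiniteFrame : BijFrame → Set
FiniteFrame 𝔉 = Σ ℕ λ n → BijFrame.Carrier 𝔉 ↔ Fin n

_,_⊨_ : (M : Model) → Model.Carrier M → Formula → Set
M , w ⊨ atom p   = Model.val M p w
M , w ⊨ (¬' φ)   = ¬ (M , w ⊨ φ)
M , w ⊨ (φ ∧' ψ) = (M , w ⊨ φ) × (M , w ⊨ ψ)
M , w ⊨ X' φ     = M , Model.next M w ⊨ φ
M , w ⊨ Y' φ     = M , Model.prev M w ⊨ φ
M , w ⊨ F' φ     = Σ ℕ λ k → M , Model.fwd M k w ⊨ φ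
M , w ⊨ P' φ     = Σ ℕ λ k → M , Model.bwd M k w ⊨ φ

SatisfiableBij : Formula → Set₁
SatisfiableBij φ = Σ Model λ M → Σ (Model.Carrier M) λ w → M , w ⊨ φ

SatisfiableFinBij : Formula → Set₁
SatisfiableFinBij φ =
  Σ Model λ M → FiniteFrame (Model.frame M) × Σ (Model.Carrier M) λ w → M , w ⊨ φ

{-# OPTIONS --safe #-}
-- On a finite bijective frame the orbit of every point under S is a cycle, so
-- whatever lies in the future of a point also lies in its past: F φ implies P φ,
-- which refutes F q ∧ ¬ P q. On ℤ with S the successor and q true only at 1,
-- the formula holds at 0, since the past of 0 lies below 0.
module Submission where

open import Defs
open import Data.Product using (Σ; ∃; _×_; _,_)
open import Relation.Nullary using (¬_)
open import Data.Nat using (zero; suc; _+_; _*_)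
open import Data.Nat.Properties using (+-comm; +-suc; *-suc; n<1+n; m≤n⇒∃[o]m+o≡n)
open import Data.Integer as ℤ using (ℤ; +_; +≤+)
open import Data.Integer.Properties using (≤-refl; suc-pred; pred-suc; i≤j⇒pred[i]≤j)
open import Data.Fin using (toℕ)
open import Data.Fin.Properties using (pigeonhole)
open import Function.Bundles using (Inverse; Injection; mk↔ₛ′)
open import Function.Properties.Inverse using (↔⇒↣)
open import Relation.Binary.PropositionalEquality using (_≡_; refl; sym; trans; cong; subst; module ≡-Reasoning)

module BijFrameProperties (𝔉 : BijFrame) where
  open BijFrame 𝔉
  open ≡-Reasoning

  fwd-+ : ∀ a b w → fwd (a + b) w ≡ fwd a (fwd b w)
  fwd-+ zero    b w = refl
  fwd-+ (suc a) b w = cong next (fwd-+ a b w)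

  fwd-sucʳ : ∀ m w → fwd (suc m) w ≡ fwd m (next w)
  fwd-sucʳ m w = begin
    fwd (suc m) w   ≡⟨ cong (λ n → fwd n w) (+-comm 1 m) ⟩
    fwd (m + 1) w   ≡⟨ fwd-+ m 1 w ⟩
    fwd m (next w)  ∎

  bwd-fwd : ∀ m w → bwd m (fwd m w) ≡ w
  bwd-fwd zero    w = refl
  bwd-fwd (suc m) w = begin
    prev (bwd m (fwd (suc m) w))  ≡⟨ cong (λ v → prev (bwd m v)) (fwd-sucʳ m w) ⟩
    prev (bwd m (fwd m (next w))) ≡⟨ cong prev (bwd-fwd m (next w)) ⟩
    prev (next w)                 ≡⟨ Inverse.strictlyInverseʳ S w ⟩
    w                             ∎

  fwd-injective : ∀ m {x y} → fwd m x ≡ fwd m y → x ≡ y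
  fwd-injective m {x} {y} eq = begin
    x                ≡⟨ sym (bwd-fwd m x) ⟩
    bwd m (fwd m x)  ≡⟨ cong (bwd m) eq ⟩
    bwd m (fwd m y)  ≡⟨ bwd-fwd m y ⟩
    y                ∎

  fwd-*-period : ∀ {p w} → fwd p w ≡ w → ∀ c → fwd (c * p) w ≡ w
  fwd-*-period         period zero    = refl
  fwd-*-period {p} {w} period (suc c) = begin
    fwd (p + c * p) w      ≡⟨ fwd-+ p (c * p) w ⟩
    fwd p (fwd (c * p) w)  ≡⟨ cong (fwd p) (fwd-*-period period c) ⟩
    fwd p w                ≡⟨ period ⟩
    w                      ∎

  periodic⇒fwd≡bwd : ∀ {p w} → fwd (suc p) w ≡ w → ∀ k → fwd k w ≡ bwd (k * p) w
  periodic⇒fwd≡bwd {p} {w} period k = begin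
    fwd k w                              ≡⟨ sym (bwd-fwd (k * p) (fwd k w)) ⟩
    bwd (k * p) (fwd (k * p) (fwd k w))  ≡⟨ cong (bwd (k * p)) (sym (fwd-+ (k * p) k w)) ⟩
    bwd (k * p) (fwd (k * p + k) w)      ≡⟨ cong (λ n → bwd (k * p) (fwd n w)) k*p+k≡k*[1+p] ⟩
    bwd (k * p) (fwd (k * suc p) w)      ≡⟨ cong (bwd (k * p)) (fwd-*-period period k) ⟩
    bwd (k * p) w                        ∎
    where
    k*p+k≡k*[1+p] : k * p + k ≡ k * suc p
    k*p+k≡k*[1+p] = trans (+-comm (k * p) k) (sym (*-suc k p))

  finite⇒periodic : FiniteFrame 𝔉 → ∀ w → ∃ λ p → fwd (suc p) w ≡ w
  finite⇒periodic (n , iso) w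
    with i , j , i<j , orbitᵢ≡orbitⱼ ← pigeonhole (n<1+n n) (λ i → Inverse.to iso (fwd (toℕ i) w))
    with p , 1+i+p≡j ← m≤n⇒∃[o]m+o≡n i<j
    = p , fwd-injective (toℕ i) (begin
      fwd (toℕ i) (fwd (suc p) w)  ≡⟨ sym (fwd-+ (toℕ i) (suc p) w) ⟩
      fwd (toℕ i + suc p) w        ≡⟨ cong (λ m → fwd m w) (trans (+-suc (toℕ i) p) 1+i+p≡j) ⟩
      fwd (toℕ j) w                ≡⟨ sym (Injection.injective (↔⇒↣ iso) orbitᵢ≡orbitⱼ) ⟩
      fwd (toℕ i) w                ∎)

  finite⇒fwd-reachable⇒bwd-reachable : FiniteFrame 𝔉 → ∀ k w → ∃ λ m → fwd k w ≡ bwd m w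
  finite⇒fwd-reachable⇒bwd-reachable finite k w with p , period ← finite⇒periodic finite w =
    k * p , periodic⇒fwd≡bwd period k

open BijFrameProperties using (finite⇒fwd-reachable⇒bwd-reachable)

finite⇒⊨F⇒⊨P : (M : Model) → FiniteFrame (Model.frame M) →
               ∀ {w} φ → M , w ⊨ F' φ → M , w ⊨ P' φ
finite⇒⊨F⇒⊨P M finite {w} φ (k , ⊨φ)
  with m , fwdₖ≡bwdₘ ← finite⇒fwd-reachable⇒bwd-reachable (Model.frame M) finite k w =
  m , subst (λ v → M , v ⊨ φ) fwdₖ≡bwdₘ ⊨φ

F∧¬P : Atom → Formula
F∧¬P q = F' (atom q) ∧' (¬' P' (atom q))

F∧¬P-unsatisfiable-finite : ∀ q → ¬ SatisfiableFinBij (F∧¬P q)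
F∧¬P-unsatisfiable-finite q (M , finite , _ , ⊨Fq , ⊭Pq) = ⊭Pq (finite⇒⊨F⇒⊨P M finite (atom q) ⊨Fq)

ℤ-frame : BijFrame
ℤ-frame = record { Carrier = ℤ ; S = mk↔ₛ′ ℤ.suc ℤ.pred suc-pred pred-suc }

bwd-≤ : ∀ k i → BijFrame.bwd ℤ-frame k i ℤ.≤ i
bwd-≤ zero    i = ≤-refl
bwd-≤ (suc k) i = i≤j⇒pred[i]≤j (bwd-≤ k i)

ℤ-model : Model
ℤ-model = record { frame = ℤ-frame ; val = λ _ i → i ≡ + 1 }

F∧¬P-satisfiable : ∀ q → SatisfiableBij (F∧¬P q)
F∧¬P-satisfiable q = ℤ-model , + 0 , (1 , refl) , ⊭Pq
  where
  ⊭Pq : ¬ (ℤ-model , + 0 ⊨ P' (atom q))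
  ⊭Pq (k , bwdₖ0≡1) with subst (ℤ._≤ + 0) bwdₖ0≡1 (bwd-≤ k (+ 0))
  ... | +≤+ ()

mainTheorem3 : Σ Formula λ φ → SatisfiableBij φ × ¬ SatisfiableFinBij φ
mainTheorem3 = F∧¬P 0 , F∧¬P-satisfiable 0 , F∧¬P-unsatisfiable-finite 0
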